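{- Let $G$ be a finite undirected graph, $k$ a positive integer, and $v_1,\dots,v_k$ (not necessarily pairwise distinct) vertices all belonging to the same $k$-edge-connectivity class. If $u$ is a vertex and there exist $k$ pairwise edge-disjoint ttrails from $u$ to $v_1,\dots,v_k$ respectively, then $u$ is $k$-edge-connected to $v_1$.
   Context: Graphs are finite, undirected, may have multiple edges and loops, and need not be connected. A truncated trail (ttrail) from $x$ to $y$ is a sequence $v_1,e_1,\dots,v_n,e_n$ with $v_1=x$, each $e_j$ joining $v_j$ and $v_{j+1}$ (where $v_{n+1}=y$), and the edges pairwise distinct. Two distinct vertices are $k$-edge-connected if there are $k$ pairwise edge-disjoint ttrails between them; every vertex is $k$-edge-connected to itself; this is an equivalence relation whose classes are the $k$-edge-connectivity classes. -}

module Defs where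

open import Data.Nat using (ℕ; suc)
open import Data.Fin using (Fin)
open import Data.Product using (Σ; _×_; _,_)
open import Data.Sum using (_⊎_)
open import Data.List using (List; []; _∷_)
open import Data.List.Relation.Unary.Unique.Propositional using (Unique)
open import Data.List.Relation.Binary.Disjoint.Propositional using (Disjoint)
open import Relation.Binary.PropositionalEquality using (_≡_; _≢_)

-- A finite multigraph (loops and parallel edges allowed): vertices Fin n,
-- edges Fin m, each edge has an (unordered) pair of endpoints.
record Graph : Set where
  field
    nV : ℕ
    nE : ℕ
    ends : Fin nE → Fin nV × Fin nV

open Graph public

Vertex : Graph → Set
Vertex G = Fin (nV G)

Edge : Graph → Set
Edge G = Fin (nE G)

Joins : (G : Graph) → Edge G → Vertex G → Vertex G → Set
Joins G e x y = (ends G e ≡ (x , y)) ⊎ (ends G e ≡ (y , x))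

data Walk (G : Graph) : Vertex G → Vertex G → List (Edge G) → Set where
  []  : ∀ {x} → Walk G x x []
  _∷_ : ∀ {x y z e es} → Joins G e x y → Walk G y z es → Walk G x z (e ∷ es)

record TTrail (G : Graph) (x y : Vertex G) : Set where
  constructor ttrail
  field
    edges : List (Edge G)
    walk  : Walk G x y edges
    distinct : Unique edges

open TTrail public

EdgeDisjoint : ∀ {G : Graph} {x y x' y' : Vertex G} → TTrail G x y → TTrail G x' y' → Set
EdgeDisjoint P Q = Disjoint (edges P) (edges Q)

DisjointTTrails : (G : Graph) (k : ℕ) (x y : Vertex G) → Set
DisjointTTrails G k x y =
  Σ (Fin k → TTrail G x y) λ T → ∀ i j → i ≢ j → EdgeDisjoint (T i) (T j)

EdgeConnected : (G : Graph) (k : ℕ) (x y : Vertex G) → Set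
EdgeConnected G k x y = (x ≡ y) ⊎ ((x ≢ y) × DisjointTTrails G k x y)

-- By Menger's theorem, if u is not k-edge-connected to v₁ there is a vertex set S with u ∈ S and
-- v₁ ∉ S out of which fewer than k pairwise edge-disjoint trails can lead.  If some vᵢ lies in S,
-- the k edge-disjoint trails between vᵢ and v₁ lead out of S; otherwise the k given trails from u
-- to the vᵢ do.
--
-- Menger's theorem for s and t is proved by augmenting paths.  A flow orients some of the edges; a flow of
-- value j peels off into j edge-disjoint trails, and j edge-disjoint trails merge back into a flow
-- of value j.  When no residual path reaches t, the set S of vertices reached is closed under
-- residual edges, so every trail of the flow leaves S at most once and every trail leaving S does
-- so along an edge of the flow; hence at most j edge-disjoint trails leave S.

module Submission where

open import Defs
open import Data.Nat using (ℕ; zero; suc; _+_; _*_; _<_; _∸_; s≤s; z≤n)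
open import Data.Nat.Properties
  using (+-0-commutativeMonoid; +-commutativeSemigroup; +-comm; +-identityʳ; +-suc; +-cancelˡ-≡; +-cancelʳ-≡;
         *-zeroʳ; m+1+n≢0; ≤-reflexive; ≤-trans; m<m+n; n≮n; ∸-monoʳ-<)
  renaming (_≟_ to _≟ℕ_)
open import Data.Nat.Tactic.RingSolver using (solve-∀)
open import Algebra.Properties.CommutativeSemigroup +-commutativeSemigroup using (x∙yz≈y∙xz; xy∙z≈xz∙y; interchange)
open import Data.Nat.Induction using (<-wellFounded)
open import Induction.WellFounded using (Acc; acc)
open import Algebra.Properties.CommutativeMonoid.Sum +-0-commutativeMonoid
  using (sum; sum-remove; ∑-distrib-+; sum-cong-≗; sum-replicate-zero)
open import Data.Fin using (Fin; zero; suc; _≟_; punchIn)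
open import Data.Fin.Properties using (¬∀⟶∃¬; any?; punchInᵢ≢i; injective⇒≤; suc-injective)
open import Data.Fin.Subset using (Subset; ⁅_⁆; _∪_; ∣_∣)
  renaming (_∈_ to _∈ₛ_; _∉_ to _∉ₛ_)
open import Data.Fin.Subset.Properties using (x∈⁅x⁆; x∈⁅y⁆⇒x≡y; x∈p∪q⁺; x∈p∪q⁻; p⊂q⇒∣p∣<∣q∣; ∣p∣≤n)
  renaming (_∈?_ to _∈ₛ?_)
open import Data.Vec.Functional using (updateAt; removeAt)
open import Data.Vec.Functional.Properties using (updateAt-updates; updateAt-minimal)
open import Data.Product as Product using (Σ; ∃; ∃₂; _×_; _,_; proj₁; proj₂)
open import Data.Product.Properties using (≡-dec; ,-injective)
open import Data.Sum as Sum using (_⊎_; inj₁; inj₂)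
open import Data.Empty using (⊥-elim)
open import Data.Unit using (⊤; tt)
open import Data.List using (List; []; _∷_)
open import Data.List.Membership.Propositional using (_∈_; _∉_)
import Data.List.Membership.DecPropositional as DecMembership
open import Data.List.Relation.Unary.Any using (here; there)
open import Data.List.Relation.Unary.All as All using (All; []; _∷_)
open import Data.List.Relation.Unary.All.Properties using (All¬⇒¬Any; ¬Any⇒All¬)
open import Data.List.Relation.Unary.AllPairs using ([]; _∷_)
open import Data.List.Relation.Unary.Unique.Propositional using (Unique)
open import Function using (_∘_; const; id)
open import Relation.Nullary using (¬_; Dec; yes; no; contradiction)
open import Relation.Nullary.Decidable using (_×-dec_; _⊎-dec_; ¬?)
open import Relation.Binary.Definitions using (DecidableEquality)
open import Relation.Binary.PropositionalEquality

sum-update : ∀ {n} (f g : Fin n → ℕ) i → (∀ j → j ≢ i → f j ≡ g j) → sum f + g i ≡ sum g + f i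
sum-update {suc n} f g i f≡g = begin
  sum f + g i                     ≡⟨ cong (_+ g i) (sum-remove f) ⟩
  f i + sum (removeAt f i) + g i  ≡⟨ cong (λ r → f i + r + g i) (sum-cong-≗ off-i) ⟩
  f i + sum (removeAt g i) + g i  ≡⟨ exchange (f i) (sum (removeAt g i)) (g i) ⟩
  g i + sum (removeAt g i) + f i  ≡⟨ cong (_+ f i) (sum-remove g) ⟨
  sum g + f i                     ∎
  where
  open ≡-Reasoning
  off-i : ∀ j → removeAt f i j ≡ removeAt g i j
  off-i j = f≡g (punchIn i j) (punchInᵢ≢i i j)
  exchange : ∀ a r b → a + r + b ≡ b + r + a
  exchange = solve-∀

sum-updateAt : ∀ {n} {A : Set} (h : Fin n → A → ℕ) (f : Fin n → A) i x →
               sum (λ j → h j (updateAt f i (const x) j)) + h i (f i) ≡ sum (λ j → h j (f j)) + h i x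
sum-updateAt h f i x = trans (sum-update _ _ i off-i) (cong (λ z → _ + h i z) (updateAt-updates i f))
  where
  off-i : ∀ j → j ≢ i → h j (updateAt f i (const x) j) ≡ h j (f j)
  off-i j j≢i = cong (h j) (updateAt-minimal j i f j≢i)

sum≢0⇒∃≢0 : ∀ {n} (f : Fin n → ℕ) → sum f ≢ 0 → ∃ λ i → f i ≢ 0
sum≢0⇒∃≢0 {n} f sum≢0 = ¬∀⟶∃¬ n (λ i → f i ≡ 0) (λ i → f i ≟ℕ 0)
  λ all≡0 → sum≢0 (trans (sum-cong-≗ all≡0) (sum-replicate-zero n))

δ : ∀ {n} → Fin n → Fin n → ℕ
δ a y with a ≟ y
... | yes _ = 1
... | no  _ = 0

δ-refl : ∀ {n} (a : Fin n) → δ a a ≡ 1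
δ-refl a with a ≟ a
... | yes _   = refl
... | no  a≢a = contradiction refl a≢a

δ-≢ : ∀ {n} {a y : Fin n} → a ≢ y → δ a y ≡ 0
δ-≢ {a = a} {y} a≢y with a ≟ y
... | yes a≡y = contradiction a≡y a≢y
... | no  _   = refl

δ≢0⇒≡ : ∀ {n} {a y : Fin n} → δ a y ≢ 0 → a ≡ y
δ≢0⇒≡ {a = a} {y} δ≢0 with a ≟ y
... | yes a≡y = a≡y
... | no  _   = contradiction refl δ≢0

data Direction : Set where
  unused forward backward : Direction

_≟ᵈ_ : DecidableEquality Direction
unused   ≟ᵈ unused   = yes refl
forward  ≟ᵈ forward  = yes refl
backward ≟ᵈ backward = yes refl
unused   ≟ᵈ forward  = no λ ()
unused   ≟ᵈ backward = no λ ()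
forward  ≟ᵈ unused   = no λ ()
forward  ≟ᵈ backward = no λ ()
backward ≟ᵈ unused   = no λ ()
backward ≟ᵈ forward  = no λ ()

weight : Direction → ℕ
weight unused = 0
weight _      = 1

weight-used : ∀ {d} → d ≢ unused → weight d ≡ 1
weight-used {unused}   d≢unused = contradiction refl d≢unused
weight-used {forward}  _        = refl
weight-used {backward} _        = refl

_∨ᵈ_ : Direction → Direction → Direction
unused   ∨ᵈ d = d
forward  ∨ᵈ _ = forward
backward ∨ᵈ _ = backward

∨ᵈ-identityʳ : ∀ d → d ∨ᵈ unused ≡ d
∨ᵈ-identityʳ unused   = refl
∨ᵈ-identityʳ forward  = refl
∨ᵈ-identityʳ backward = refl

∨ᵈ-used : ∀ {d} d' → d ≢ unused → d ∨ᵈ d' ≡ d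
∨ᵈ-used {unused}   _ d≢unused = contradiction refl d≢unused
∨ᵈ-used {forward}  _ _        = refl
∨ᵈ-used {backward} _ _        = refl

module _ (G : Graph) where

  -- A flow is a set of edges, each traversed in one direction; forward runs from
  -- the first to the second vertex of ends G e.
  Flow : Set
  Flow = Edge G → Direction

  Oriented : Direction → Edge G → Vertex G → Vertex G → Set
  Oriented d e a b = (d ≡ forward × ends G e ≡ (a , b)) ⊎ (d ≡ backward × ends G e ≡ (b , a))

  Residual : Direction → Edge G → Vertex G → Vertex G → Set
  Residual d e a b = (d ≡ unused × Joins G e a b) ⊎ Oriented d e b a

  tailAt headAt : Direction → Edge G → Vertex G → ℕ
  tailAt unused   e = const 0
  tailAt forward  e = δ (proj₁ (ends G e))
  tailAt backward e = δ (proj₂ (ends G e))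
  headAt unused   e = const 0
  headAt forward  e = δ (proj₂ (ends G e))
  headAt backward e = δ (proj₁ (ends G e))

  module _ {d : Direction} {e : Edge G} {a b : Vertex G} where

    tailAt-oriented : Oriented d e a b → ∀ y → tailAt d e y ≡ δ a y
    tailAt-oriented (inj₁ (refl , ends≡)) y = cong (λ p → δ (proj₁ p) y) ends≡
    tailAt-oriented (inj₂ (refl , ends≡)) y = cong (λ p → δ (proj₂ p) y) ends≡

    headAt-oriented : Oriented d e a b → ∀ y → headAt d e y ≡ δ b y
    headAt-oriented (inj₁ (refl , ends≡)) y = cong (λ p → δ (proj₂ p) y) ends≡
    headAt-oriented (inj₂ (refl , ends≡)) y = cong (λ p → δ (proj₁ p) y) ends≡

    oriented⇒joins : Oriented d e a b → Joins G e a b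
    oriented⇒joins (inj₁ (_ , ends≡)) = inj₁ ends≡
    oriented⇒joins (inj₂ (_ , ends≡)) = inj₂ ends≡

    oriented⇒used : Oriented d e a b → d ≢ unused
    oriented⇒used (inj₁ (refl , _)) ()
    oriented⇒used (inj₂ (refl , _)) ()

    oriented-functional : ∀ {a' b'} → Oriented d e a b → Oriented d e a' b' → a ≡ a' × b ≡ b'
    oriented-functional (inj₁ (refl , p)) (inj₁ (_ , q)) = ,-injective (trans (sym p) q)
    oriented-functional (inj₂ (refl , p)) (inj₂ (_ , q)) = Product.swap (,-injective (trans (sym p) q))
    oriented-functional (inj₁ (refl , _)) (inj₂ (() , _))
    oriented-functional (inj₂ (refl , _)) (inj₁ (() , _))

  residual⇒joins : ∀ {d e a b} → Residual d e a b → Joins G e a b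
  residual⇒joins (inj₁ (_ , ab)) = ab
  residual⇒joins (inj₂ ba)       = Sum.swap (oriented⇒joins ba)

  orientation : ∀ {e a b} → Joins G e a b → ∃ λ d → Oriented d e a b
  orientation (inj₁ ends≡) = forward  , inj₁ (refl , ends≡)
  orientation (inj₂ ends≡) = backward , inj₂ (refl , ends≡)

  tailAt≢0⇒oriented : ∀ d e x → tailAt d e x ≢ 0 → ∃ λ y → Oriented d e x y
  tailAt≢0⇒oriented unused   e x tail≢0 = contradiction refl tail≢0
  tailAt≢0⇒oriented forward  e x tail≢0 =
    proj₂ (ends G e) , inj₁ (refl , cong (_, proj₂ (ends G e)) (δ≢0⇒≡ tail≢0))
  tailAt≢0⇒oriented backward e x tail≢0 =
    proj₁ (ends G e) , inj₂ (refl , cong (proj₁ (ends G e) ,_) (δ≢0⇒≡ tail≢0))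

  ¬residual⇒oriented : ∀ d {e a b} → Joins G e a b → ¬ Residual d e a b → Oriented d e a b
  ¬residual⇒oriented unused   ab        ¬res = contradiction (inj₁ (refl , ab)) ¬res
  ¬residual⇒oriented forward  (inj₁ eq) ¬res = inj₁ (refl , eq)
  ¬residual⇒oriented forward  (inj₂ eq) ¬res = contradiction (inj₂ (inj₁ (refl , eq))) ¬res
  ¬residual⇒oriented backward (inj₁ eq) ¬res = contradiction (inj₂ (inj₂ (refl , eq))) ¬res
  ¬residual⇒oriented backward (inj₂ eq) ¬res = inj₂ (refl , eq)

  residual? : ∀ d e a b → Dec (Residual d e a b)
  residual? d e a b = ((d ≟ᵈ unused) ×-dec joins?) ⊎-dec oriented?
    where
    _≟ₚ_ : DecidableEquality (Vertex G × Vertex G)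
    _≟ₚ_ = ≡-dec _≟_ _≟_
    joins? : Dec (Joins G e a b)
    joins? = (ends G e ≟ₚ (a , b)) ⊎-dec (ends G e ≟ₚ (b , a))
    oriented? : Dec (Oriented d e b a)
    oriented? = ((d ≟ᵈ forward) ×-dec (ends G e ≟ₚ (b , a))) ⊎-dec ((d ≟ᵈ backward) ×-dec (ends G e ≟ₚ (a , b)))

  degree : (Direction → Edge G → Vertex G → ℕ) → Flow → Vertex G → ℕ
  degree c o y = sum λ e → c (o e) e y

  outdeg indeg : Flow → Vertex G → ℕ
  outdeg = degree tailAt
  indeg  = degree headAt

  size : Flow → ℕ
  size o = sum (weight ∘ o)

  -- Conservation with external demand: A y units of flow end at y and B y units start at y.
  Conserves : Flow → (Vertex G → ℕ) → (Vertex G → ℕ) → Set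
  Conserves o A B = ∀ y → outdeg o y + A y ≡ indeg o y + B y

  infixl 9 _[_≔_]
  _[_≔_] : Flow → Edge G → Direction → Flow
  o [ e ≔ d ] = updateAt o e (const d)

  module _ (c : Direction → Edge G → Vertex G → ℕ) {o : Flow} {e : Edge G} (y : Vertex G)
           (c-unused : c unused e y ≡ 0) where

    degree-add : ∀ {d} → o e ≡ unused → degree c (o [ e ≔ d ]) y ≡ degree c o y + c d e y
    degree-add {d} oe≡unused = begin
      degree c (o [ e ≔ d ]) y                 ≡⟨ +-identityʳ _ ⟨
      degree c (o [ e ≔ d ]) y + 0             ≡⟨ cong (degree c (o [ e ≔ d ]) y +_) c-unused ⟨
      degree c (o [ e ≔ d ]) y + c unused e y  ≡⟨ cong (λ d' → degree c (o [ e ≔ d ]) y + c d' e y) oe≡unused ⟨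
      degree c (o [ e ≔ d ]) y + c (o e) e y   ≡⟨ sum-updateAt (λ e' d' → c d' e' y) o e d ⟩
      degree c o y + c d e y                   ∎
      where open ≡-Reasoning

    degree-erase : degree c (o [ e ≔ unused ]) y + c (o e) e y ≡ degree c o y
    degree-erase = trans (sum-updateAt (λ e' d' → c d' e' y) o e unused)
                         (trans (cong (degree c o y +_) c-unused) (+-identityʳ _))

  module _ {o : Flow} {e : Edge G} {a b : Vertex G} (y : Vertex G) where

    outdeg-add : ∀ {d} → o e ≡ unused → Oriented d e a b → outdeg (o [ e ≔ d ]) y ≡ outdeg o y + δ a y
    outdeg-add oe≡unused ab = trans (degree-add tailAt y refl oe≡unused) (cong (outdeg o y +_) (tailAt-oriented ab y))

    indeg-add : ∀ {d} → o e ≡ unused → Oriented d e a b → indeg (o [ e ≔ d ]) y ≡ indeg o y + δ b y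
    indeg-add oe≡unused ab = trans (degree-add headAt y refl oe≡unused) (cong (indeg o y +_) (headAt-oriented ab y))

    outdeg-erase : Oriented (o e) e a b → outdeg (o [ e ≔ unused ]) y + δ a y ≡ outdeg o y
    outdeg-erase ab = trans (cong (outdeg (o [ e ≔ unused ]) y +_) (sym (tailAt-oriented ab y))) (degree-erase tailAt y refl)

    indeg-erase : Oriented (o e) e a b → indeg (o [ e ≔ unused ]) y + δ b y ≡ indeg o y
    indeg-erase ab = trans (cong (indeg (o [ e ≔ unused ]) y +_) (sym (headAt-oriented ab y))) (degree-erase headAt y refl)

  size-erase : ∀ o e → o e ≢ unused → size (o [ e ≔ unused ]) < size o
  size-erase o e used = ≤-reflexive (begin
    suc (size o')           ≡⟨ +-comm 1 _ ⟩
    size o' + 1             ≡⟨ cong (size o' +_) (weight-used used) ⟨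
    size o' + weight (o e)  ≡⟨ sum-updateAt (λ _ → weight) o e unused ⟩
    size o + 0              ≡⟨ +-identityʳ _ ⟩
    size o                  ∎)
    where
    open ≡-Reasoning
    o' : Flow
    o' = o [ e ≔ unused ]

  module _ {o : Flow} {A B : Vertex G → ℕ} where

    conserves-+ˡ : ∀ (C : Vertex G → ℕ) → Conserves o A B → Conserves o (λ y → C y + A y) (λ y → C y + B y)
    conserves-+ˡ C cons y = begin
      outdeg o y + (C y + A y)  ≡⟨ x∙yz≈y∙xz (outdeg o y) (C y) (A y) ⟩
      C y + (outdeg o y + A y)  ≡⟨ cong (C y +_) (cons y) ⟩
      C y + (indeg o y + B y)   ≡⟨ x∙yz≈y∙xz (C y) (indeg o y) (B y) ⟩
      indeg o y + (C y + B y)   ∎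
      where open ≡-Reasoning

    conserves-cancelˡ : ∀ (C : Vertex G → ℕ) → Conserves o (λ y → C y + A y) (λ y → C y + B y) → Conserves o A B
    conserves-cancelˡ C cons y = +-cancelˡ-≡ (C y) _ _ (begin
      C y + (outdeg o y + A y)  ≡⟨ x∙yz≈y∙xz (C y) (outdeg o y) (A y) ⟩
      outdeg o y + (C y + A y)  ≡⟨ cons y ⟩
      indeg o y + (C y + B y)   ≡⟨ x∙yz≈y∙xz (indeg o y) (C y) (B y) ⟩
      C y + (indeg o y + B y)   ∎)
      where open ≡-Reasoning

    module _ {e : Edge G} {a b : Vertex G} where
      open ≡-Reasoning

      private
        shuffle : ∀ m p q r → m + p + (q + r) ≡ m + (p + r) + q
        shuffle = solve-∀

      add-arc-moves-sink : ∀ {d} → o e ≡ unused → Oriented d e a b →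
        Conserves o (λ y → δ a y + A y) B → Conserves (o [ e ≔ d ]) (λ y → δ b y + A y) B
      add-arc-moves-sink {d} oe≡unused ab cons y = begin
        outdeg (o [ e ≔ d ]) y + (δ b y + A y)  ≡⟨ cong (_+ (δ b y + A y)) (outdeg-add y oe≡unused ab) ⟩
        outdeg o y + δ a y + (δ b y + A y)     ≡⟨ shuffle (outdeg o y) (δ a y) (δ b y) (A y) ⟩
        outdeg o y + (δ a y + A y) + δ b y     ≡⟨ cong (_+ δ b y) (cons y) ⟩
        indeg o y + B y + δ b y                ≡⟨ xy∙z≈xz∙y (indeg o y) (B y) (δ b y) ⟩
        indeg o y + δ b y + B y                ≡⟨ cong (_+ B y) (indeg-add y oe≡unused ab) ⟨
        indeg (o [ e ≔ d ]) y + B y            ∎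

      erase-arc-moves-sink : Oriented (o e) e b a →
        Conserves o (λ y → δ a y + A y) B → Conserves (o [ e ≔ unused ]) (λ y → δ b y + A y) B
      erase-arc-moves-sink ba cons y = +-cancelʳ-≡ (δ a y) _ _ (begin
        outdeg o' y + (δ b y + A y) + δ a y    ≡⟨ shuffle′ (outdeg o' y) (δ b y) (A y) (δ a y) ⟩
        outdeg o' y + δ b y + (δ a y + A y)    ≡⟨ cong (_+ (δ a y + A y)) (outdeg-erase y ba) ⟩
        outdeg o y + (δ a y + A y)             ≡⟨ cons y ⟩
        indeg o y + B y                        ≡⟨ cong (_+ B y) (indeg-erase y ba) ⟨
        indeg o' y + δ a y + B y               ≡⟨ xy∙z≈xz∙y (indeg o' y) (δ a y) (B y) ⟩
        indeg o' y + B y + δ a y               ∎)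
        where
        o' : Flow
        o' = o [ e ≔ unused ]
        shuffle′ : ∀ m p q r → m + (p + q) + r ≡ m + p + (r + q)
        shuffle′ = solve-∀

      erase-arc-moves-source : Oriented (o e) e a b →
        Conserves o A (λ y → δ a y + B y) → Conserves (o [ e ≔ unused ]) A (λ y → δ b y + B y)
      erase-arc-moves-source ab cons y = +-cancelʳ-≡ (δ a y) _ _ (begin
        outdeg o' y + A y + δ a y              ≡⟨ xy∙z≈xz∙y (outdeg o' y) (A y) (δ a y) ⟩
        outdeg o' y + δ a y + A y              ≡⟨ cong (_+ A y) (outdeg-erase y ab) ⟩
        outdeg o y + A y                       ≡⟨ cons y ⟩
        indeg o y + (δ a y + B y)              ≡⟨ cong (_+ (δ a y + B y)) (indeg-erase y ab) ⟨
        indeg o' y + δ b y + (δ a y + B y)     ≡⟨ shuffle (indeg o' y) (δ b y) (δ a y) (B y) ⟩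
        indeg o' y + (δ b y + B y) + δ a y     ∎)
        where
        o' : Flow
        o' = o [ e ≔ unused ]

  add-arc-moves-source : ∀ {o e d a b} {A : Vertex G → ℕ} → o e ≡ unused → Oriented d e a b →
    Conserves o A (δ b) → Conserves (o [ e ≔ d ]) A (δ a)
  add-arc-moves-source {o} {e} {d} {a} {b} {A} oe≡unused ab cons y = begin
    outdeg (o [ e ≔ d ]) y + A y   ≡⟨ cong (_+ A y) (outdeg-add y oe≡unused ab) ⟩
    outdeg o y + δ a y + A y      ≡⟨ xy∙z≈xz∙y (outdeg o y) (δ a y) (A y) ⟩
    outdeg o y + A y + δ a y      ≡⟨ cong (_+ δ a y) (cons y) ⟩
    indeg o y + δ b y + δ a y     ≡⟨ cong (_+ δ a y) (indeg-add y oe≡unused ab) ⟨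
    indeg (o [ e ≔ d ]) y + δ a y ∎
    where
    open ≡-Reasoning

  infix 4 _⊆ᶠ_
  _⊆ᶠ_ : Flow → Flow → Set
  o' ⊆ᶠ o = ∀ e → o' e ≡ o e ⊎ o' e ≡ unused

  ⊆ᶠ-refl : ∀ {o} → o ⊆ᶠ o
  ⊆ᶠ-refl e = inj₁ refl

  ⊆ᶠ-trans : ∀ {o'' o' o} → o'' ⊆ᶠ o' → o' ⊆ᶠ o → o'' ⊆ᶠ o
  ⊆ᶠ-trans o''⊆o' o'⊆o e with o''⊆o' e | o'⊆o e
  ... | inj₁ eq  | inj₁ eq' = inj₁ (trans eq eq')
  ... | inj₁ eq  | inj₂ eq' = inj₂ (trans eq eq')
  ... | inj₂ eq  | _        = inj₂ eq

  ⊆ᶠ-unused : ∀ {o' o e} → o' ⊆ᶠ o → o e ≡ unused → o' e ≡ unused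
  ⊆ᶠ-unused {e = e} o'⊆o oe≡unused with o'⊆o e
  ... | inj₁ eq = trans eq oe≡unused
  ... | inj₂ eq = eq

  ⊆ᶠ-used : ∀ {o' o e} → o' ⊆ᶠ o → o' e ≢ unused → o e ≢ unused
  ⊆ᶠ-used o'⊆o o'e-used oe≡unused = o'e-used (⊆ᶠ-unused o'⊆o oe≡unused)

  erase-⊆ᶠ : ∀ o e → o [ e ≔ unused ] ⊆ᶠ o
  erase-⊆ᶠ o e e' with e' ≟ e
  ... | yes refl = inj₂ (updateAt-updates e o)
  ... | no e'≢e  = inj₁ (updateAt-minimal e' e o e'≢e)

  Follows : ∀ {a b es} → Flow → Walk G a b es → Set
  Follows o []                        = ⊤
  Follows o (_∷_ {x} {y} {e = e} _ W) = Oriented (o e) e x y × Follows o W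

  follows-cong : ∀ {a b es} (W : Walk G a b es) {o o'} →
                 (∀ {e} → e ∈ es → o e ≡ o' e) → Follows o W → Follows o' W
  follows-cong []                o≡o' _             = tt
  follows-cong (_∷_ {e = e} _ W) o≡o' (arc , arcs) =
    subst (λ d → Oriented d e _ _) (o≡o' (here refl)) arc , follows-cong W (o≡o' ∘ there) arcs

  follows-used : ∀ {a b es} (W : Walk G a b es) {o e} → Follows o W → e ∈ es → o e ≢ unused
  follows-used (_ ∷ W) (arc , _)    (here refl) = oriented⇒used arc
  follows-used (_ ∷ W) (_   , arcs) (there e∈)  = follows-used W arcs e∈

  flowOf : ∀ {a b es} → Walk G a b es → Flow
  flowOf []                 = const unused
  flowOf (_∷_ {e = e} ab W) = flowOf W [ e ≔ proj₁ (orientation ab) ]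

  flowOf-∉ : ∀ {a b es e} (W : Walk G a b es) → e ∉ es → flowOf W e ≡ unused
  flowOf-∉ []                 _  = refl
  flowOf-∉ (_∷_ {e = e₀} _ W) e∉ = trans (updateAt-minimal _ e₀ (flowOf W) (e∉ ∘ here)) (flowOf-∉ W (e∉ ∘ there))

  flowOf-used⇒∈ : ∀ {a b es e} (W : Walk G a b es) → flowOf W e ≢ unused → e ∈ es
  flowOf-used⇒∈ []                         used = contradiction refl used
  flowOf-used⇒∈ {e = e} (_∷_ {e = e₀} _ W) used with e ≟ e₀
  ... | yes e≡e₀ = here e≡e₀
  ... | no  e≢e₀ = there (flowOf-used⇒∈ W (used ∘ trans (updateAt-minimal e e₀ (flowOf W) e≢e₀)))

  flowOf-conserves : ∀ {a b es} (W : Walk G a b es) → Unique es → Conserves (flowOf W) (δ b) (δ a)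
  flowOf-conserves []       _          y = refl
  flowOf-conserves (ab ∷ W) (e∉ ∷ uniq) =
    add-arc-moves-source (flowOf-∉ W (All¬⇒¬Any e∉)) (proj₂ (orientation ab)) (flowOf-conserves W uniq)

  flowOf-follows : ∀ {a b es} (W : Walk G a b es) → Unique es → Follows (flowOf W) W
  flowOf-follows []                       _           = tt
  flowOf-follows (_∷_ {e = e} {es} ab W) (e∉ ∷ uniq) =
    subst (λ d → Oriented d e _ _) (sym (updateAt-updates e (flowOf W))) (proj₂ (orientation ab)) ,
    follows-cong W unchanged (flowOf-follows W uniq)
    where
    unchanged : ∀ {e'} → e' ∈ es → flowOf W e' ≡ flowOf (ab ∷ W) e'
    unchanged {e'} e'∈ = sym (updateAt-minimal e' e (flowOf W) λ e'≡e → All¬⇒¬Any e∉ (subst (_∈ es) e'≡e e'∈))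

  infixr 6 _⊕_
  _⊕_ : Flow → Flow → Flow
  (o₁ ⊕ o₂) e = o₁ e ∨ᵈ o₂ e

  Separate : Flow → Flow → Set
  Separate o₁ o₂ = ∀ e → o₁ e ≡ unused ⊎ o₂ e ≡ unused

  degree-⊕ : ∀ c {o₁ o₂} → (∀ e y → c unused e y ≡ 0) → Separate o₁ o₂ →
             ∀ y → degree c (o₁ ⊕ o₂) y ≡ degree c o₁ y + degree c o₂ y
  degree-⊕ c {o₁} {o₂} c-unused sep y =
    trans (sum-cong-≗ split) (∑-distrib-+ (λ e → c (o₁ e) e y) (λ e → c (o₂ e) e y))
    where
    split : ∀ e → c (o₁ e ∨ᵈ o₂ e) e y ≡ c (o₁ e) e y + c (o₂ e) e y
    split e with sep e
    ... | inj₁ o₁e≡unused rewrite o₁e≡unused | c-unused e y = refl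
    ... | inj₂ o₂e≡unused rewrite o₂e≡unused | c-unused e y | ∨ᵈ-identityʳ (o₁ e) = sym (+-identityʳ _)

  conserves-⊕ : ∀ {o₁ o₂ A₁ A₂ B₁ B₂} → Separate o₁ o₂ → Conserves o₁ A₁ B₁ → Conserves o₂ A₂ B₂ →
                Conserves (o₁ ⊕ o₂) (λ y → A₁ y + A₂ y) (λ y → B₁ y + B₂ y)
  conserves-⊕ {o₁} {o₂} {A₁} {A₂} {B₁} {B₂} sep cons₁ cons₂ y = begin
    outdeg (o₁ ⊕ o₂) y + (A₁ y + A₂ y)              ≡⟨ cong (_+ (A₁ y + A₂ y)) (degree-⊕ tailAt (λ _ _ → refl) sep y) ⟩
    outdeg o₁ y + outdeg o₂ y + (A₁ y + A₂ y)      ≡⟨ interchange (outdeg o₁ y) (outdeg o₂ y) (A₁ y) (A₂ y) ⟩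
    (outdeg o₁ y + A₁ y) + (outdeg o₂ y + A₂ y)    ≡⟨ cong₂ _+_ (cons₁ y) (cons₂ y) ⟩
    (indeg o₁ y + B₁ y) + (indeg o₂ y + B₂ y)      ≡⟨ interchange (indeg o₁ y) (B₁ y) (indeg o₂ y) (B₂ y) ⟩
    indeg o₁ y + indeg o₂ y + (B₁ y + B₂ y)        ≡⟨ cong (_+ (B₁ y + B₂ y)) (degree-⊕ headAt (λ _ _ → refl) sep y) ⟨
    indeg (o₁ ⊕ o₂) y + (B₁ y + B₂ y)              ∎
    where open ≡-Reasoning

  push : ∀ o {e a b} → Residual (o e) e a b → Flow
  push o {e} (inj₁ (_ , ab)) = o [ e ≔ proj₁ (orientation ab) ]
  push o {e} (inj₂ _)        = o [ e ≔ unused ]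

  push-moves-sink : ∀ {o e a b} {A B : Vertex G → ℕ} (r : Residual (o e) e a b) →
    Conserves o (λ y → δ a y + A y) B → Conserves (push o r) (λ y → δ b y + A y) B
  push-moves-sink (inj₁ (oe≡unused , ab)) = add-arc-moves-sink oe≡unused (proj₂ (orientation ab))
  push-moves-sink (inj₂ ba)               = erase-arc-moves-sink ba

  push-elsewhere : ∀ {o e a b e'} (r : Residual (o e) e a b) → e' ≢ e → push o r e' ≡ o e'
  push-elsewhere {o} {e} {e' = e'} (inj₁ _) e'≢e = updateAt-minimal e' e o e'≢e
  push-elsewhere {o} {e} {e' = e'} (inj₂ _) e'≢e = updateAt-minimal e' e o e'≢e

  Inside : Subset (nV G) → Edge G → Set
  Inside S e = proj₁ (ends G e) ∈ₛ S × proj₂ (ends G e) ∈ₛ S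

  joins-inside : ∀ {S e a b} → Joins G e a b → a ∈ₛ S → b ∈ₛ S → Inside S e
  joins-inside {S} (inj₁ ends≡) a∈S b∈S = subst (λ p → proj₁ p ∈ₛ S × proj₂ p ∈ₛ S) (sym ends≡) (a∈S , b∈S)
  joins-inside {S} (inj₂ ends≡) a∈S b∈S = subst (λ p → proj₁ p ∈ₛ S × proj₂ p ∈ₛ S) (sym ends≡) (b∈S , a∈S)

  inside-endpoint : ∀ {S e a b} → Joins G e a b → Inside S e → b ∈ₛ S
  inside-endpoint {S} (inj₁ ends≡) (_ , q∈S) = subst (_∈ₛ S) (cong proj₂ ends≡) q∈S
  inside-endpoint {S} (inj₂ ends≡) (p∈S , _) = subst (_∈ₛ S) (cong proj₁ ends≡) p∈S

  walk-exits : ∀ S {x y es} → Walk G x y es → x ∈ₛ S → y ∉ₛ S →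
               ∃ λ e → e ∈ es × ∃₂ λ a b → Joins G e a b × a ∈ₛ S × b ∉ₛ S
  walk-exits S []                                    x∈S y∉S = contradiction x∈S y∉S
  walk-exits S (_∷_ {x} {y = c} {e = e} xc W) x∈S y∉S with c ∈ₛ? S
  ... | yes c∈S = Product.map₂ (Product.map₁ there) (walk-exits S W c∈S y∉S)
  ... | no  c∉S = e , here refl , x , c , xc , x∈S , c∉S

  Closed : Flow → Subset (nV G) → Set
  Closed o S = ∀ {a b e} → a ∈ₛ S → Residual (o e) e a b → b ∈ₛ S

  -- The trail-packing form of "fewer than k edges leave S".
  BoundaryBelow : ℕ → Subset (nV G) → Set
  BoundaryBelow k S = ∀ {n} (xs ys : Fin n → Vertex G) (Q : ∀ i → TTrail G (xs i) (ys i)) →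
    (∀ i i' → i ≢ i' → EdgeDisjoint (Q i) (Q i')) → (∀ i → xs i ∈ₛ S) → (∀ i → ys i ∉ₛ S) → n < k

  Leaves : Flow → Subset (nV G) → Edge G → Set
  Leaves o S e = ∃₂ λ a b → Oriented (o e) e a b × a ∈ₛ S × b ∉ₛ S

  leaves-used : ∀ {o S e} → Leaves o S e → o e ≢ unused
  leaves-used (_ , _ , ab , _) = oriented⇒used ab

  module _ {o : Flow} {S : Subset (nV G)} (closed : Closed o S) where

    exit-leaves : ∀ {e a b} → Joins G e a b → a ∈ₛ S → b ∉ₛ S → Leaves o S e
    exit-leaves {e} {a} {b} ab a∈S b∉S =
      a , b , ¬residual⇒oriented (o e) ab (λ r → b∉S (closed a∈S r)) , a∈S , b∉S

    -- An arc of o entering S would be a residual edge leaving S.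
    stays-outside : ∀ {x y es} (W : Walk G x y es) → Follows o W → x ∉ₛ S →
                    ∀ {e a b} → e ∈ es → Oriented (o e) e a b → a ∉ₛ S
    stays-outside (_ ∷ _) (xc , _) x∉S (here refl) ab =
      subst (_∉ₛ S) (proj₁ (oriented-functional xc ab)) x∉S
    stays-outside (_ ∷ W) (xc , arcs) x∉S (there e∈) ab =
      stays-outside W arcs (λ c∈S → x∉S (closed c∈S (inj₂ xc))) e∈ ab

    leaves-once : ∀ {x y es} (W : Walk G x y es) → Follows o W →
                  ∀ {e e'} → e ∈ es → e' ∈ es → Leaves o S e → Leaves o S e' → e ≡ e'
    leaves-once (_ ∷ _) _           (here refl) (here refl) _ _ = refl
    leaves-once (_ ∷ W) (xc , arcs) (here refl) (there e'∈) (_ , _ , ab , _ , b∉S) (_ , _ , a'b' , a'∈S , _) =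
      contradiction a'∈S (stays-outside W arcs (subst (_∉ₛ S) (proj₂ (oriented-functional ab xc)) b∉S) e'∈ a'b')
    leaves-once (_ ∷ W) (xc , arcs) (there e∈) (here refl) (_ , _ , ab , a∈S , _) (_ , _ , a'b' , _ , b'∉S) =
      contradiction a∈S (stays-outside W arcs (subst (_∉ₛ S) (proj₂ (oriented-functional a'b' xc)) b'∉S) e∈ ab)
    leaves-once (_ ∷ W) (_ , arcs) (there e∈) (there e'∈) l l' = leaves-once W arcs e∈ e'∈ l l'

  open DecMembership (_≟_ {nE G}) using () renaming (_∈?_ to _∈ₗ?_)

  module _ (s t : Vertex G) where

    _HasValue_ : Flow → ℕ → Set
    o HasValue j = Conserves o (λ y → j * δ t y) (λ y → j * δ s y)

    PairwiseDisjoint : ∀ {j} → (Fin j → TTrail G s t) → Set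
    PairwiseDisjoint T = ∀ i i' → i ≢ i' → EdgeDisjoint (T i) (T i')

    module _ {j} (T : Fin (suc j) → TTrail G s t) (disjoint : PairwiseDisjoint T) where

      disjoint-tail : PairwiseDisjoint (T ∘ suc)
      disjoint-tail i i' i≢i' = disjoint (suc i) (suc i') (i≢i' ∘ suc-injective)

      disjoint-head : ∀ {e} i → e ∈ edges (T zero) → e ∉ edges (T (suc i))
      disjoint-head i e∈₀ e∈ = disjoint zero (suc i) (λ ()) (e∈₀ , e∈)

    union : ∀ {j} → (Fin j → TTrail G s t) → Flow
    union {zero}  T = const unused
    union {suc j} T = flowOf (walk (T zero)) ⊕ union (T ∘ suc)

    union-∉ : ∀ {j e} (T : Fin j → TTrail G s t) → (∀ i → e ∉ edges (T i)) → union T e ≡ unused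
    union-∉ {zero}      T _  = refl
    union-∉ {suc j} {e} T e∉ =
      trans (cong (_∨ᵈ union (T ∘ suc) e) (flowOf-∉ (walk (T zero)) (e∉ zero))) (union-∉ (T ∘ suc) (e∉ ∘ suc))

    union-separate : ∀ {j} (T : Fin (suc j) → TTrail G s t) → PairwiseDisjoint T →
                     Separate (flowOf (walk (T zero))) (union (T ∘ suc))
    union-separate T disjoint e with e ∈ₗ? edges (T zero)
    ... | yes e∈₀ = inj₂ (union-∉ (T ∘ suc) λ i → disjoint-head T disjoint i e∈₀)
    ... | no  e∉₀ = inj₁ (flowOf-∉ (walk (T zero)) e∉₀)

    union-value : ∀ {j} (T : Fin j → TTrail G s t) → PairwiseDisjoint T → union T HasValue j
    union-value {zero}  T _        y = refl
    union-value {suc j} T disjoint   = conserves-⊕ (union-separate T disjoint)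
      (flowOf-conserves (walk (T zero)) (distinct (T zero))) (union-value (T ∘ suc) (disjoint-tail T disjoint))

    union-agrees : ∀ {j} (T : Fin j → TTrail G s t) → PairwiseDisjoint T →
                   ∀ i {e} → e ∈ edges (T i) → union T e ≡ flowOf (walk (T i)) e
    union-agrees {suc j} T disjoint zero e∈ =
      ∨ᵈ-used _ (follows-used (walk (T zero)) (flowOf-follows (walk (T zero)) (distinct (T zero))) e∈)
    union-agrees {suc j} T disjoint (suc i) {e} e∈ =
      trans (cong (_∨ᵈ union (T ∘ suc) e) (flowOf-∉ (walk (T zero)) λ e∈₀ → disjoint-head T disjoint i e∈₀ e∈))
            (union-agrees (T ∘ suc) (disjoint-tail T disjoint) i e∈)

    union-follows : ∀ {j} (T : Fin j → TTrail G s t) → PairwiseDisjoint T → ∀ i → Follows (union T) (walk (T i))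
    union-follows T disjoint i =
      follows-cong (walk (T i)) (sym ∘ union-agrees T disjoint i) (flowOf-follows (walk (T i)) (distinct (T i)))

    union-used⇒∈ : ∀ {j} (T : Fin j → TTrail G s t) {e} → union T e ≢ unused → ∃ λ i → e ∈ edges (T i)
    union-used⇒∈ {zero}  T     used = contradiction refl used
    union-used⇒∈ {suc j} T {e} used with flowOf (walk (T zero)) e ≟ᵈ unused
    ... | no  used₀   = zero , flowOf-used⇒∈ (walk (T zero)) used₀
    ... | yes unused₀ = Product.map suc id (union-used⇒∈ (T ∘ suc) (used ∘ trans (cong (_∨ᵈ union (T ∘ suc) e) unused₀)))

    -- The edge list is in reverse order.
    data ResidualPath (o : Flow) : Vertex G → List (Edge G) → Set where
      []  : ResidualPath o s []
      _▷_ : ∀ {a b e es} → ResidualPath o a es → Residual (o e) e a b → ResidualPath o b (e ∷ es)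

    augment : ∀ {o y es} {A B : Vertex G → ℕ} → ResidualPath o y es → Unique es →
              Conserves o (λ z → δ s z + A z) B →
              ∃ λ o' → Conserves o' (λ z → δ y z + A z) B × (∀ {e} → e ∉ es → o' e ≡ o e)
    augment {o} []                   _            cons = o , cons , λ _ → refl
    augment (_▷_ {a} {b} {e} path r) (e∉ ∷ uniq) cons with augment path uniq cons
    ... | o₁ , cons₁ , o₁≡o = push o₁ r₁ , push-moves-sink {o₁} r₁ cons₁ ,
                              λ e'∉ → trans (push-elsewhere r₁ (e'∉ ∘ here)) (o₁≡o (e'∉ ∘ there))
      where
      r₁ : Residual (o₁ e) e a b
      r₁ = subst (λ d → Residual d e a b) (sym (o₁≡o (All¬⇒¬Any e∉))) r

    augment-value : ∀ {o j es} → ResidualPath o t es → Unique es → o HasValue j → ∃ λ o' → o' HasValue suc j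
    augment-value {o} path uniq value = Product.map₂ proj₁ (augment path uniq (conserves-+ˡ {o} (δ s) value))

    record Peel (o : Flow) (j : ℕ) (x : Vertex G) : Set where
      field
        trail       : TTrail G x t
        trail-used  : ∀ {e} → e ∈ edges trail → o e ≢ unused
        rest        : Flow
        rest-⊆      : rest ⊆ᶠ o
        rest-avoids : ∀ {e} → e ∈ edges trail → rest e ≡ unused
        rest-value  : rest HasValue j

    outdeg≢0 : ∀ {o j x} → x ≢ t →
               Conserves o (λ y → suc j * δ t y) (λ y → δ x y + j * δ s y) → outdeg o x ≢ 0
    outdeg≢0 {o} {j} {x} x≢t cons out≡0 = m+1+n≢0 (indeg o x) (begin
      indeg o x + suc (j * δ s x)      ≡⟨ cong (λ n → indeg o x + (n + j * δ s x)) (δ-refl x) ⟨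
      indeg o x + (δ x x + j * δ s x)  ≡⟨ cons x ⟨
      outdeg o x + suc j * δ t x       ≡⟨ cong₂ (λ m n → m + suc j * n) out≡0 (δ-≢ (x≢t ∘ sym)) ⟩
      suc j * 0                        ≡⟨ *-zeroʳ (suc j) ⟩
      0                                ∎)
      where open ≡-Reasoning

    peel : ∀ {o j x} → Acc _<_ (size o) →
           Conserves o (λ y → suc j * δ t y) (λ y → δ x y + j * δ s y) → Peel o j x
    peel {o} {j} {x} (acc smaller) cons with x ≟ t
    ... | yes refl = record
      { trail = ttrail [] [] []; trail-used = λ (); rest = o; rest-⊆ = ⊆ᶠ-refl
      ; rest-avoids = λ (); rest-value = conserves-cancelˡ {o} (δ t) cons }
    ... | no x≢t with sum≢0⇒∃≢0 (λ e → tailAt (o e) e x) (outdeg≢0 {o} {j} x≢t cons)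
    ... | e , tail≢0 with tailAt≢0⇒oriented (o e) e x tail≢0
    ... | y , xy = extend (peel (smaller (size-erase o e (oriented⇒used xy))) (erase-arc-moves-source {o} xy cons))
      where
      extend : Peel (o [ e ≔ unused ]) j y → Peel o j x
      extend P = record
        { trail       = ttrail (e ∷ edges trail) (oriented⇒joins xy ∷ walk trail) (¬Any⇒All¬ _ e∉ ∷ distinct trail)
        ; trail-used  = λ { (here refl) → oriented⇒used xy ; (there e'∈) → ⊆ᶠ-used (erase-⊆ᶠ o e) (trail-used e'∈) }
        ; rest        = rest
        ; rest-⊆      = ⊆ᶠ-trans rest-⊆ (erase-⊆ᶠ o e)
        ; rest-avoids = λ { (here refl) → ⊆ᶠ-unused rest-⊆ (updateAt-updates e o) ; (there e'∈) → rest-avoids e'∈ }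
        ; rest-value  = rest-value }
        where
        open Peel P
        e∉ : e ∉ edges trail
        e∉ e∈ = trail-used e∈ (updateAt-updates e o)

    decompose : ∀ {o} j → o HasValue j →
                Σ (Fin j → TTrail G s t) λ T → PairwiseDisjoint T × (∀ i {e} → e ∈ edges (T i) → o e ≢ unused)
    decompose zero    _     = (λ ()) , (λ ()) , (λ ())
    decompose {o} (suc j) value with peel {o} {j} (<-wellFounded (size o)) value
    ... | P with decompose {Peel.rest P} j (Peel.rest-value P)
    ... | T , disjoint , T-used = T′ , disjoint′ , used′
      where
      open Peel P
      T′ : Fin (suc j) → TTrail G s t
      T′ zero    = trail
      T′ (suc i) = T i
      disjoint′ : PairwiseDisjoint T′
      disjoint′ zero    zero     0≢0  = contradiction refl 0≢0
      disjoint′ zero    (suc i)  _    (e∈₀ , e∈) = T-used i e∈ (rest-avoids e∈₀)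
      disjoint′ (suc i) zero     _    (e∈ , e∈₀) = T-used i e∈ (rest-avoids e∈₀)
      disjoint′ (suc i) (suc i') i≢i' = disjoint i i' (i≢i' ∘ cong suc)
      used′ : ∀ i {e} → e ∈ edges (T′ i) → o e ≢ unused
      used′ zero    = trail-used
      used′ (suc i) = ⊆ᶠ-used rest-⊆ ∘ T-used i

    ReachableIn : Flow → Subset (nV G) → Vertex G → Set
    ReachableIn o S y = ∃ λ es → ResidualPath o y es × Unique es × All (Inside S) es

    Exploration : Flow → Set
    Exploration o = (∃ λ es → ResidualPath o t es × Unique es) ⊎ (∃ λ S → s ∈ₛ S × t ∉ₛ S × Closed o S)

    explore : ∀ o S → Acc _<_ (nV G ∸ ∣ S ∣) → s ∈ₛ S → (∀ {y} → y ∈ₛ S → ReachableIn o S y) → Exploration o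
    explore o S (acc smaller) s∈S reach with t ∈ₛ? S
    ... | yes t∈S = let es , path , uniq , _ = reach t∈S in inj₁ (es , path , uniq)
    ... | no  t∉S with any? (λ a → any? (λ b → any? (λ e → (a ∈ₛ? S) ×-dec ¬? (b ∈ₛ? S) ×-dec residual? (o e) e a b)))
    ... | no  stuck = inj₂ (S , s∈S , t∉S , closed)
      where
      closed : Closed o S
      closed {a} {b} {e} a∈S r with b ∈ₛ? S
      ... | yes b∈S = b∈S
      ... | no  b∉S = contradiction (a , b , e , a∈S , b∉S , r) stuck
    ... | yes (a , b , e , a∈S , b∉S , r) = explore o S′ (smaller shrinks) (S⊆S′ s∈S) reach′
      where
      S′ : Subset (nV G)
      S′ = S ∪ ⁅ b ⁆
      S⊆S′ : ∀ {y} → y ∈ₛ S → y ∈ₛ S′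
      S⊆S′ y∈S = x∈p∪q⁺ (inj₁ y∈S)
      b∈S′ : b ∈ₛ S′
      b∈S′ = x∈p∪q⁺ (inj₂ (x∈⁅x⁆ b))
      shrinks : nV G ∸ ∣ S′ ∣ < nV G ∸ ∣ S ∣
      shrinks = ∸-monoʳ-< (p⊂q⇒∣p∣<∣q∣ (S⊆S′ , b , b∈S′ , b∉S)) (∣p∣≤n S′)
      widen : ∀ {y} → ReachableIn o S y → ReachableIn o S′ y
      widen (es , path , uniq , inside) = es , path , uniq , All.map (Product.map S⊆S′ S⊆S′) inside
      reach′ : ∀ {y} → y ∈ₛ S′ → ReachableIn o S′ y
      reach′ y∈S′ with x∈p∪q⁻ S ⁅ b ⁆ y∈S′
      ... | inj₁ y∈S = widen (reach y∈S)
      ... | inj₂ y∈⁅b⁆ with refl ← x∈⁅y⁆⇒x≡y b y∈⁅b⁆ =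
        let es , path , uniq , inside = reach a∈S
            e∉ : e ∉ es
            e∉ e∈ = b∉S (inside-endpoint (residual⇒joins r) (All.lookup inside e∈))
        in e ∷ es , path ▷ r , ¬Any⇒All¬ es e∉ ∷ uniq ,
           joins-inside (residual⇒joins r) (S⊆S′ a∈S) b∈S′ ∷ All.map (Product.map S⊆S′ S⊆S′) inside

    explore-from-s : ∀ o → Exploration o
    explore-from-s o = explore o ⁅ s ⁆ (<-wellFounded _) (x∈⁅x⁆ s) start
      where
      start : ∀ {y} → y ∈ₛ ⁅ s ⁆ → ReachableIn o ⁅ s ⁆ y
      start y∈⁅s⁆ with refl ← x∈⁅y⁆⇒x≡y s y∈⁅s⁆ = [] , [] , [] , []

    cut-bound : ∀ {j} (T : Fin j → TTrail G s t) → PairwiseDisjoint T →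
                ∀ {S} → Closed (union T) S → BoundaryBelow (suc j) S
    cut-bound {j} T disjoint {S} closed xs ys Q Q-disjoint xs∈S ys∉S = s≤s (injective⇒≤ owner-injective)
      where
      exit : ∀ i → ∃ λ e → e ∈ edges (Q i) × Leaves (union T) S e
      exit i with walk-exits S (walk (Q i)) (xs∈S i) (ys∉S i)
      ... | e , e∈ , a , b , ab , a∈S , b∉S = e , e∈ , exit-leaves closed ab a∈S b∉S
      owner : ∀ i → ∃ λ m → proj₁ (exit i) ∈ edges (T m)
      owner i = union-used⇒∈ T (leaves-used {union T} (proj₂ (proj₂ (exit i))))
      owner-injective : ∀ {i i'} → proj₁ (owner i) ≡ proj₁ (owner i') → i ≡ i'
      owner-injective {i} {i'} same-owner with i ≟ i'
      ... | yes i≡i' = i≡i'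
      ... | no  i≢i' = contradiction (proj₁ (proj₂ (exit i)) , subst (_∈ edges (Q i')) (sym same-exit) (proj₁ (proj₂ (exit i'))))
                                     (Q-disjoint i i' i≢i')
        where
        m : Fin j
        m = proj₁ (owner i)
        same-exit : proj₁ (exit i) ≡ proj₁ (exit i')
        same-exit = leaves-once closed (walk (T m)) (union-follows T disjoint m) (proj₂ (owner i))
                      (subst (λ m' → proj₁ (exit i') ∈ edges (T m')) (sym same-owner) (proj₂ (owner i')))
                      (proj₂ (proj₂ (exit i))) (proj₂ (proj₂ (exit i')))

    Menger : ℕ → Set
    Menger k = DisjointTTrails G k s t ⊎ ∃ λ S → s ∈ₛ S × t ∉ₛ S × BoundaryBelow k S

    grow : ∀ d {j} (T : Fin j → TTrail G s t) → PairwiseDisjoint T → Menger (j + d)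
    grow zero {j} T disjoint = inj₁ (subst (λ k → DisjointTTrails G k s t) (sym (+-identityʳ j)) (T , disjoint))
    grow (suc d) {j} T disjoint with explore-from-s (union T)
    ... | inj₁ (_ , path , uniq) =
      let o′ , value′ = augment-value {j = j} path uniq (union-value T disjoint)
          T′ , disjoint′ , _ = decompose {o′} (suc j) value′
      in subst Menger (sym (+-suc j d)) (grow d T′ disjoint′)
    ... | inj₂ (S , s∈S , t∉S , closed) = inj₂ (S , s∈S , t∉S , λ xs ys Q Q-disjoint xs∈S ys∉S →
      ≤-trans (cut-bound T disjoint closed xs ys Q Q-disjoint xs∈S ys∉S) (m<m+n j (s≤s z≤n)))

  menger : ∀ k s t → Menger s t k
  menger k s t = grow s t k (λ ()) (λ ())

mainTheorem7 : (G : Graph) (k' : ℕ) (v : Fin (suc k') → Vertex G) (u : Vertex G)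
    → (∀ i j → EdgeConnected G (suc k') (v i) (v j))
    → (T : (i : Fin (suc k')) → TTrail G u (v i))
    → (∀ i j → i ≢ j → EdgeDisjoint (T i) (T j))
    → EdgeConnected G (suc k') u (v zero)
mainTheorem7 G k' v u linked T disjoint with u ≟ v zero
... | yes u≡v₀ = inj₁ u≡v₀
... | no  u≢v₀ with menger G (suc k') u (v zero)
... | inj₁ trails = inj₂ (u≢v₀ , trails)
... | inj₂ (S , u∈S , v₀∉S , thin) with any? (λ i → v i ∈ₛ? S)
... | no  v∉S = ⊥-elim (n≮n _ (thin (const u) v T disjoint (const u∈S) λ i vᵢ∈S → v∉S (i , vᵢ∈S)))
... | yes (i , vᵢ∈S) with linked i zero
... | inj₁ vᵢ≡v₀ = ⊥-elim (v₀∉S (subst (_∈ₛ S) vᵢ≡v₀ vᵢ∈S))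
... | inj₂ (_ , Q , Q-disjoint) =
  ⊥-elim (n≮n _ (thin (const (v i)) (const (v zero)) Q Q-disjoint (const vᵢ∈S) (const v₀∉S)))
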